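{- There exists a prelambda congruence which is not an extensional congruence.
   Context: Let $\mathbb{V}$ be an infinite set whose elements are called variables. The set $\mathbb{T}$ of terms is the set of words inductively defined by: every variable $x$ is a term; if $A,B$ are terms then $[AB]$ is a term; if $x$ is a variable and $A$ a term then $[\lambda x A]$ is a term. Equality of terms is syntactic identity. We abbreviate $[AB]$ as $AB$ and $[\lambda x A]$ as $\lambda x A$. A binary relation $\sim$ on $\mathbb{T}$ is a congruence if it is reflexive, symmetric, transitive, and for all terms $A,B,C,D$ and every variable $x$: $A\sim B$ implies $\lambda x A \sim \lambda x B$, and $A\sim B$, $C \sim D$ imply $AC \sim BD$. A prelambda congruence is a congruence $\sim$ such that for all terms $A,B,D$ and all variables $x,y$: ($\beta_1$) $[\lambda x x]D \sim D$; ($\beta_2$) $[\lambda x y]D \sim y$ whenever $x\neq y$; ($\beta_3$) $[\lambda x[AB]]D \sim [[\lambda x A]D][[\lambda x B]D]$; ($\beta_4$) $[\lambda x[\lambda x A]]D \sim \lambda x A$; ($\beta_5$) if $x \neq y$ and $[\lambda y D]x \sim D$, then $[\lambda x[\lambda y A]]D \sim \lambda y[[\lambda x A]D]$. An extensional congruence is a prelambda congruence $\sim$ satisfying ($\eta_e$): $y \sim \lambda x[yx]$ for all variables $x, y$ with $x \neq y$. -}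

module Defs where

open import Data.Nat using (ℕ)
open import Data.Product using (_×_)
open import Relation.Binary.PropositionalEquality using (_≡_)
open import Relation.Nullary using (¬_)

Var : Set
Var = ℕ

data Term : Set where
  var : Var → Term
  app : Term → Term → Term
  lam : Var → Term → Term

Rel : Set₁
Rel = Term → Term → Set

record IsCongruence (_∼_ : Rel) : Set where
  field
    refl    : ∀ A → A ∼ A
    sym     : ∀ {A B} → A ∼ B → B ∼ A
    trans   : ∀ {A B C} → A ∼ B → B ∼ C → A ∼ C
    lam-cong : ∀ {A B} x → A ∼ B → lam x A ∼ lam x B
    app-cong : ∀ {A B C D} → A ∼ B → C ∼ D → app A C ∼ app B D

record IsPrelambda (_∼_ : Rel) : Set where
  field
    congruence : IsCongruence _∼_
    β₁ : ∀ x D → app (lam x (var x)) D ∼ D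
    β₂ : ∀ x y D → ¬ (x ≡ y) → app (lam x (var y)) D ∼ var y
    β₃ : ∀ x A B D →
         app (lam x (app A B)) D ∼ app (app (lam x A) D) (app (lam x B) D)
    β₄ : ∀ x A D → app (lam x (lam x A)) D ∼ lam x A
    β₅ : ∀ x y A D → ¬ (x ≡ y) → app (lam y D) (var x) ∼ D →
         app (lam x (lam y A)) D ∼ lam y (app (lam x A) D)

IsExtensional : Rel → Set
IsExtensional _∼_ =
  IsPrelambda _∼_ ×
  (∀ x y → ¬ (x ≡ y) → var y ∼ lam x (app (var y) (var x)))

-- Interpret terms in Engeler's graph model: a token is an atom or an arrow l ⇒ t with
-- l a finite list of tokens, a λ-abstraction denotes only arrows, and application
-- collects the results t of arrows l ⇒ t whose inputs l all lie in the argument.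
-- Identifying terms with the same denotation under every environment gives a
-- congruence satisfying β₁–β₅; for β₃ one uses that denotations are monotone in the
-- environment, so finitely many input lists can be merged into one. It is not
-- extensional: a variable may denote an atom, which the η-expansion λx[yx], denoting
-- only arrows, never contains.
module Submission where

open import Defs
open import Data.Empty using (⊥; ⊥-elim)
open import Data.List using (List; []; _∷_; _++_)
open import Data.List.Membership.Propositional using (_∈_)
open import Data.List.Relation.Binary.Subset.Propositional using (_⊆_)
open import Data.List.Relation.Binary.Subset.Propositional.Properties
  using (xs⊆xs++ys; xs⊆ys++xs)
open import Data.List.Relation.Unary.All as All using (All; []; _∷_)
open import Data.List.Relation.Unary.All.Properties using (++⁺)
open import Data.List.Relation.Unary.Any using (here)
open import Data.Nat using (_≟_)
open import Data.Product using (Σ; _×_; _,_)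
open import Function using (_∘_)
open import Function.Bundles using (_⇔_; mk⇔; Equivalence)
open import Function.Properties.Equivalence using (⇔-isEquivalence; ⇔-setoid)
open import Level using (0ℓ)
open import Relation.Binary.Structures using (IsEquivalence)
import Relation.Binary.Reasoning.Setoid as SetoidReasoning
open import Relation.Binary.PropositionalEquality
  using (_≡_; _≢_; _≗_; refl; sym; trans; subst)
open import Relation.Nullary using (¬_; Dec; yes; no)

module ⇔ = IsEquivalence (⇔-isEquivalence {0ℓ})
open Equivalence using (to; from)
module EquivalenceReasoning = SetoidReasoning (⇔-setoid 0ℓ)

data Token : Set where
  atom : Var → Token
  _⇒_  : List Token → Token → Token

Env : Set
Env = Var → List Token

infixl 9 _[_↦_]
infix 4 _⊆ₑ_

_[_↦_] : Env → Var → List Token → Env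
(ρ [ x ↦ l ]) z with x ≟ z
... | yes _ = l
... | no  _ = ρ z

_⊆ₑ_ : Env → Env → Set
ρ ⊆ₑ ρ′ = ∀ z → ρ z ⊆ ρ′ z

update-≡ : ∀ ρ x l → (ρ [ x ↦ l ]) x ≡ l
update-≡ ρ x l with x ≟ x
... | yes _  = refl
... | no x≢x = ⊥-elim (x≢x refl)

update-≢ : ∀ ρ {x z} l → x ≢ z → (ρ [ x ↦ l ]) z ≡ ρ z
update-≢ ρ {x} {z} l x≢z with x ≟ z
... | yes x≡z = ⊥-elim (x≢z x≡z)
... | no  _   = refl

update-shadow : ∀ ρ x l l′ → ρ [ x ↦ l ] [ x ↦ l′ ] ≗ ρ [ x ↦ l′ ]
update-shadow ρ x l l′ z with x ≟ z
... | yes _   = refl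
... | no  x≢z = update-≢ ρ l x≢z

update-swap : ∀ ρ {x y} l l′ → x ≢ y → ρ [ x ↦ l ] [ y ↦ l′ ] ≗ ρ [ y ↦ l′ ] [ x ↦ l ]
update-swap ρ {x} {y} l l′ x≢y z = by-cases (y ≟ z) (x ≟ z)
  where
  by-cases : Dec (y ≡ z) → Dec (x ≡ z) → (ρ [ x ↦ l ] [ y ↦ l′ ]) z ≡ (ρ [ y ↦ l′ ] [ x ↦ l ]) z
  by-cases (yes refl) (yes refl) = ⊥-elim (x≢y refl)
  by-cases (yes refl) (no  _)    = trans (update-≡ _ y l′)
                                         (sym (trans (update-≢ _ l x≢y) (update-≡ ρ y l′)))
  by-cases (no  y≢x)  (yes refl) = trans (trans (update-≢ _ l′ y≢x) (update-≡ ρ x l))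
                                         (sym (update-≡ _ x l))
  by-cases (no  y≢z)  (no  x≢z)  = trans (trans (update-≢ _ l′ y≢z) (update-≢ ρ l x≢z))
                                         (sym (trans (update-≢ _ l x≢z) (update-≢ ρ l′ y≢z)))

update-monoˡ : ∀ {ρ ρ′} x l → ρ ⊆ₑ ρ′ → ρ [ x ↦ l ] ⊆ₑ ρ′ [ x ↦ l ]
update-monoˡ x l ρ⊆ρ′ z with x ≟ z
... | yes _ = λ t∈l → t∈l
... | no  _ = ρ⊆ρ′ z

update-monoʳ : ∀ ρ x {l l′} → l ⊆ l′ → ρ [ x ↦ l ] ⊆ₑ ρ [ x ↦ l′ ]
update-monoʳ ρ x l⊆l′ z with x ≟ z
... | yes _ = l⊆l′
... | no  _ = λ t∈ρz → t∈ρz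

≗⇒⊆ₑ : ∀ {ρ ρ′} → ρ ≗ ρ′ → ρ ⊆ₑ ρ′
≗⇒⊆ₑ ρ≗ρ′ z = subst (_ ∈_) (ρ≗ρ′ z)

infixl 9 _·_

record _·_ (f a : Token → Set) (t : Token) : Set where
  constructor apply
  field
    inputs   : List Token
    inputs∈a : All a inputs
    output   : f (inputs ⇒ t)

·-cong : ∀ {f f′ a a′ : Token → Set} {t t′} →
         (∀ l → f (l ⇒ t) ⇔ f′ (l ⇒ t′)) → (∀ u → a u ⇔ a′ u) →
         (f · a) t ⇔ (f′ · a′) t′
·-cong f⇔f′ a⇔a′ = mk⇔
  (λ (apply l al fl) → apply l (All.map (to (a⇔a′ _)) al) (to (f⇔f′ l) fl))
  (λ (apply l al fl) → apply l (All.map (from (a⇔a′ _)) al) (from (f⇔f′ l) fl))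

merge-inputs : ∀ {f a : Token → Set} → (∀ {l l′ s} → l ⊆ l′ → f (l ⇒ s) → f (l′ ⇒ s)) →
               ∀ {ss} → All (f · a) ss → Σ (List Token) λ L → All a L × All (λ s → f (L ⇒ s)) ss
merge-inputs f-mono [] = [] , [] , []
merge-inputs f-mono (apply l al fl ∷ rest) with merge-inputs f-mono rest
... | L , aL , fL = l ++ L , ++⁺ al aL ,
      f-mono (xs⊆xs++ys l L) fl ∷ All.map (f-mono (xs⊆ys++xs L l)) fL

⟦_⟧ : Term → Env → Token → Set
⟦ var x ⟧   ρ t        = t ∈ ρ x
⟦ app A B ⟧ ρ t        = (⟦ A ⟧ ρ · ⟦ B ⟧ ρ) t
⟦ lam x A ⟧ ρ (atom _) = ⊥
⟦ lam x A ⟧ ρ (l ⇒ t)  = ⟦ A ⟧ (ρ [ x ↦ l ]) t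

⟦⟧-mono : ∀ A {ρ ρ′} → ρ ⊆ₑ ρ′ → ∀ {t} → ⟦ A ⟧ ρ t → ⟦ A ⟧ ρ′ t
⟦⟧-mono (var x)   ρ⊆ρ′ t∈ρx            = ρ⊆ρ′ x t∈ρx
⟦⟧-mono (app A B) ρ⊆ρ′ (apply l Bl Alt) = apply l (All.map (⟦⟧-mono B ρ⊆ρ′) Bl) (⟦⟧-mono A ρ⊆ρ′ Alt)
⟦⟧-mono (lam x A) ρ⊆ρ′ {l ⇒ t} At     = ⟦⟧-mono A (update-monoˡ x l ρ⊆ρ′) At

⟦⟧-cong-≗ : ∀ A {ρ ρ′} → ρ ≗ ρ′ → ∀ {t} → ⟦ A ⟧ ρ t ⇔ ⟦ A ⟧ ρ′ t
⟦⟧-cong-≗ A ρ≗ρ′ = mk⇔ (⟦⟧-mono A (≗⇒⊆ₑ ρ≗ρ′)) (⟦⟧-mono A (≗⇒⊆ₑ (sym ∘ ρ≗ρ′)))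

⟦lam⟧-update-bound : ∀ ρ x l A t → ⟦ lam x A ⟧ (ρ [ x ↦ l ]) t ⇔ ⟦ lam x A ⟧ ρ t
⟦lam⟧-update-bound ρ x l A (atom _) = ⇔.refl
⟦lam⟧-update-bound ρ x l A (l′ ⇒ t) = ⟦⟧-cong-≗ A (update-shadow ρ x l l′)

⟦var⟧-update-other : ∀ ρ {x y} l t → x ≢ y → ⟦ var y ⟧ (ρ [ x ↦ l ]) t ⇔ ⟦ var y ⟧ ρ t
⟦var⟧-update-other ρ {x} {y} l t x≢y = mk⇔ (subst (t ∈_) ρxy≡ρy) (subst (t ∈_) (sym ρxy≡ρy))
  where
  ρxy≡ρy : (ρ [ x ↦ l ]) y ≡ ρ y
  ρxy≡ρy = update-≢ ρ l x≢y

⟦β⟧-vacuous : ∀ ρ x B D t → (∀ l → ⟦ B ⟧ (ρ [ x ↦ l ]) t ⇔ ⟦ B ⟧ ρ t) →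
              ⟦ app (lam x B) D ⟧ ρ t ⇔ ⟦ B ⟧ ρ t
⟦β⟧-vacuous ρ x B D t B-indep = mk⇔
  (λ (apply l _ Bt) → to (B-indep l) Bt)
  (λ Bt → apply [] [] (from (B-indep []) Bt))

infix 4 _≈_

_≈_ : Rel
A ≈ B = ∀ ρ t → ⟦ A ⟧ ρ t ⇔ ⟦ B ⟧ ρ t

≈-congruence : IsCongruence _≈_
≈-congruence = record
  { refl     = λ A ρ t → ⇔.refl
  ; sym      = λ A≈B ρ t → ⇔.sym (A≈B ρ t)
  ; trans    = λ A≈B B≈C ρ t → ⇔.trans (A≈B ρ t) (B≈C ρ t)
  ; lam-cong = lam-cong
  ; app-cong = λ A≈B C≈D ρ t → ·-cong (λ l → A≈B ρ (l ⇒ t)) (C≈D ρ)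
  }
  where
  lam-cong : ∀ {A B} x → A ≈ B → lam x A ≈ lam x B
  lam-cong x A≈B ρ (atom _) = ⇔.refl
  lam-cong x A≈B ρ (l ⇒ t)  = A≈B (ρ [ x ↦ l ]) t

β₁-≈ : ∀ x D → app (lam x (var x)) D ≈ D
β₁-≈ x D ρ t = mk⇔
  (λ (apply l Dl t∈l) → All.lookup Dl (subst (t ∈_) (update-≡ ρ x l) t∈l))
  (λ Dt → apply (t ∷ []) (Dt ∷ []) (subst (t ∈_) (sym (update-≡ ρ x (t ∷ []))) (here refl)))

β₂-≈ : ∀ x y D → x ≢ y → app (lam x (var y)) D ≈ var y
β₂-≈ x y D x≢y ρ t =
  ⟦β⟧-vacuous ρ x (var y) D t (λ l → ⟦var⟧-update-other ρ l t x≢y)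

β₃-≈ : ∀ x A B D → app (lam x (app A B)) D ≈ app (app (lam x A) D) (app (lam x B) D)
β₃-≈ x A B D ρ t = mk⇔
  (λ (apply l Dl (apply l₁ Bl₁ A[l₁⇒t])) →
     apply l₁ (All.map (apply l Dl) Bl₁) (apply l Dl A[l₁⇒t]))
  collect
  where
  B-mono : ∀ {l l′ s} → l ⊆ l′ → ⟦ B ⟧ (ρ [ x ↦ l ]) s → ⟦ B ⟧ (ρ [ x ↦ l′ ]) s
  B-mono l⊆l′ = ⟦⟧-mono B (update-monoʳ ρ x l⊆l′)

  collect : ⟦ app (app (lam x A) D) (app (lam x B) D) ⟧ ρ t → ⟦ app (lam x (app A B)) D ⟧ ρ t
  collect (apply l₁ [λxB]D-l₁ (apply l₂ Dl₂ A[l₁⇒t])) with merge-inputs B-mono [λxB]D-l₁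
  ... | L , DL , BL-l₁ = apply (l₂ ++ L) (++⁺ Dl₂ DL) (apply l₁
        (All.map (B-mono (xs⊆ys++xs L l₂)) BL-l₁)
        (⟦⟧-mono A (update-monoʳ ρ x (xs⊆xs++ys l₂ L)) A[l₁⇒t]))

β₄-≈ : ∀ x A D → app (lam x (lam x A)) D ≈ lam x A
β₄-≈ x A D ρ t = ⟦β⟧-vacuous ρ x (lam x A) D t (λ l → ⟦lam⟧-update-bound ρ x l A t)

⟦⟧-update-invariant : ∀ {x y} D → x ≢ y → app (lam y D) (var x) ≈ D →
                      ∀ ρ l s → ⟦ D ⟧ (ρ [ y ↦ l ]) s ⇔ ⟦ D ⟧ ρ s
⟦⟧-update-invariant {x} {y} D x≢y [λyD]x≈D ρ l s = begin
  ⟦ D ⟧ (ρ [ y ↦ l ]) s                     ≈⟨ [λyD]x≈D (ρ [ y ↦ l ]) s ⟨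
  ⟦ app (lam y D) (var x) ⟧ (ρ [ y ↦ l ]) s ≈⟨ ·-cong lam-indep var-indep ⟩
  ⟦ app (lam y D) (var x) ⟧ ρ s             ≈⟨ [λyD]x≈D ρ s ⟩
  ⟦ D ⟧ ρ s                                 ∎
  where
  open EquivalenceReasoning
  lam-indep : ∀ l′ → ⟦ lam y D ⟧ (ρ [ y ↦ l ]) (l′ ⇒ s) ⇔ ⟦ lam y D ⟧ ρ (l′ ⇒ s)
  lam-indep = λ l′ → ⟦lam⟧-update-bound ρ y l D (l′ ⇒ s)
  var-indep : ∀ u → ⟦ var x ⟧ (ρ [ y ↦ l ]) u ⇔ ⟦ var x ⟧ ρ u
  var-indep = λ u → ⟦var⟧-update-other ρ l u (x≢y ∘ sym)

β₅-≈ : ∀ x y A D → x ≢ y → app (lam y D) (var x) ≈ D →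
       app (lam x (lam y A)) D ≈ lam y (app (lam x A) D)
β₅-≈ x y A D x≢y [λyD]x≈D ρ (atom _) = mk⇔ (λ ()) (λ ())
β₅-≈ x y A D x≢y [λyD]x≈D ρ (l′ ⇒ s) =
  ·-cong (λ l → ⟦⟧-cong-≗ A (update-swap ρ l l′ x≢y))
         (λ u → ⇔.sym (⟦⟧-update-invariant D x≢y [λyD]x≈D ρ l′ u))

≈-prelambda : IsPrelambda _≈_
≈-prelambda = record
  { congruence = ≈-congruence
  ; β₁ = β₁-≈
  ; β₂ = β₂-≈
  ; β₃ = β₃-≈
  ; β₄ = β₄-≈
  ; β₅ = β₅-≈
  }

≈-not-extensional : ¬ IsExtensional _≈_
≈-not-extensional (_ , η) = to (η 0 1 (λ ()) (λ _ → atom 0 ∷ []) (atom 0)) (here refl)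

corollary6p4 : Σ Rel (λ _∼_ → IsPrelambda _∼_ × ¬ IsExtensional _∼_)
corollary6p4 = _≈_ , ≈-prelambda , ≈-not-extensional
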